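{- Let $\mathcal{A}$ be an affine plane of order $q$ with points $p_1, \dots, p_{q^2}$ and parallel classes of lines $\mathcal{L}_1, \dots, \mathcal{L}_{q+1}$. The following are equivalent: (i) there is an assignment of a permutation $\sigma_p \in \mathfrak{S}_{q+1}$ to each point $p$ of $\mathcal{A}$ such that (a) each $\sigma_p$ is a derangement ($\sigma_p(i) \neq i$ for all $i$), and (b) for any two distinct points $p, u$, if the unique line through $p$ and $u$ belongs to $\mathcal{L}_i$, then $\sigma_p(i) \neq \sigma_u(i)$; (ii) there is a $(q+1) \times q^2$ triple array $T$ with $U_T = U_{\mathcal{A}}$, i.e., a $(q+1) \times q^2$ array in which, for all $i, j$, the set of symbols in row $i$ is exactly $R_i$ and the set of symbols in column $j$ is exactly $C_j$, where $R_i, C_j$ are the row-sets and column-sets of $U_{\mathcal{A}}$.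
   Context: An affine plane of order $q$ is a 2-$(q^2, q, 1)$ design (lines are blocks of size $q$ on $q^2$ points, any two points on exactly one line); its lines split into $q+1$ parallel classes, each partitioning the points. $U_{\mathcal{A}}$ denotes the $((q+1) \times q^2, q(q+1))$-unordered triple array whose symbols are the lines of $\mathcal{A}$, whose column-set $C_j$ ($1 \le j \le q^2$) is the set of lines through $p_j$, and whose row-set $R_i$ ($1 \le i \le q+1$) is the set of all lines not in $\mathcal{L}_i$ (up to isomorphism, this is the unique resolvable unordered triple array with these parameters whose column design is isomorphic to $\mathcal{A}$). For an array $T$, $U_T$ denotes the collection of its row symbol sets and column symbol sets. An $r \times c$ array is a triple array if no symbol repeats in a row or column, each symbol occurs equally often, and the numbers of common symbols of any row and column, of any two distinct rows, and of any two distinct columns are each constant. -}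

module Defs where

open import Data.Nat using (ℕ; zero; suc; _+_; _*_; _≤_)
open import Data.Bool using (Bool; true; false; if_then_else_; _∧_; _∨_; not)
open import Data.Fin using (Fin; _≟_)
import Data.Fin
open import Data.Fin.Permutation using (Permutation′; _⟨$⟩ʳ_)
open import Data.Product using (Σ; _×_; _,_; ∃)
open import Relation.Binary.PropositionalEquality using (_≡_; _≢_)
open import Relation.Nullary.Decidable using (⌊_⌋)
open import Function.Bundles using (_⇔_)

count : ∀ {n} → (Fin n → Bool) → ℕ
count {zero} f = 0
count {suc n} f = (if f Data.Fin.zero then 1 else 0) + count (λ x → f (Data.Fin.suc x))

sumF : ∀ {n} → (Fin n → ℕ) → ℕ
sumF {zero} f = 0
sumF {suc n} f = f Data.Fin.zero + sumF (λ x → f (Data.Fin.suc x))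

anyF : ∀ {n} → (Fin n → Bool) → Bool
anyF {zero} f = false
anyF {suc n} f = f Data.Fin.zero ∨ anyF (λ x → f (Data.Fin.suc x))

eqb : ∀ {n} → Fin n → Fin n → Bool
eqb x y = ⌊ x ≟ y ⌋

Array : ℕ → ℕ → ℕ → Set
Array r c v = Fin r → Fin c → Fin v

inRow : ∀ {r c v} → Array r c v → Fin r → Fin v → Bool
inRow T i s = anyF (λ j → eqb (T i j) s)

inCol : ∀ {r c v} → Array r c v → Fin c → Fin v → Bool
inCol T j s = anyF (λ i → eqb (T i j) s)

occ : ∀ {r c v} → Array r c v → Fin v → ℕ
occ T s = sumF (λ i → count (λ j → eqb (T i j) s))

record IsTripleArray {r c v : ℕ} (T : Array r c v) : Set where
  field
    rowNoRepeat : ∀ i j j′ → T i j ≡ T i j′ → j ≡ j′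
    colNoRepeat : ∀ j i i′ → T i j ≡ T i′ j → i ≡ i′
    equireplicate : Σ ℕ λ e → ∀ s → occ T s ≡ e
    rowColConst : Σ ℕ λ k → ∀ i j → count (λ s → inRow T i s ∧ inCol T j s) ≡ k
    rowRowConst : Σ ℕ λ k → ∀ i i′ → i ≢ i′ → count (λ s → inRow T i s ∧ inRow T i′ s) ≡ k
    colColConst : Σ ℕ λ k → ∀ j j′ → j ≢ j′ → count (λ s → inCol T j s ∧ inCol T j′ s) ≡ k

-- An affine plane of order q (q ≥ 2) with points p_1..p_{q²} (= Fin (q*q)),
-- b lines (= Fin b), boolean incidence, and a labelling of its lines into
-- q+1 parallel classes L_1..L_{q+1}, each partitioning the point set.
record AffinePlane (q : ℕ) : Set where
  field
    order≥2 : 2 ≤ q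
    nLines : ℕ
    inc : Fin (q * q) → Fin nLines → Bool
    lineSize : ∀ l → count (λ p → inc p l) ≡ q
    joinExists : ∀ p u → p ≢ u → Σ (Fin nLines) λ l → (inc p l ≡ true) × (inc u l ≡ true)
    joinUnique : ∀ p u → p ≢ u → ∀ l l′ → inc p l ≡ true → inc u l ≡ true →
                 inc p l′ ≡ true → inc u l′ ≡ true → l ≡ l′
    cls : Fin nLines → Fin (suc q)
    classPartition : ∀ i p → Σ (Fin nLines) λ l → (cls l ≡ i) × (inc p l ≡ true)
    classDisjoint : ∀ i p l l′ → cls l ≡ i → cls l′ ≡ i → inc p l ≡ true → inc p l′ ≡ true → l ≡ l′

module _ {q : ℕ} (A : AffinePlane q) where
  open AffinePlane A

  GoodDerangementAssignment : (Fin (q * q) → Permutation′ (suc q)) → Set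
  GoodDerangementAssignment σ =
    (∀ p i → σ p ⟨$⟩ʳ i ≢ i) ×
    (∀ p u → p ≢ u → ∀ l → inc p l ≡ true → inc u l ≡ true →
       σ p ⟨$⟩ʳ cls l ≢ σ u ⟨$⟩ʳ cls l)

  -- U_T = U_A : row i has symbol set R_i (lines not in L_i),
  -- column j has symbol set C_j (lines through p_j).
  RealizesUA : Array (suc q) (q * q) nLines → Set
  RealizesUA T =
    (∀ i l → (Σ (Fin (q * q)) λ j → T i j ≡ l) ⇔ (cls l ≢ i)) ×
    (∀ j l → (Σ (Fin (suc q)) λ i → T i j ≡ l) ⇔ (inc j l ≡ true))

{-# OPTIONS --safe #-}
module Submission where

-- Given σ, put into cell (i, p) the line through p whose class is σₚ⁻¹(i). Column p then
-- lists the q + 1 lines through p; (a) keeps row i inside Rᵢ, and (b) says that the two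
-- cells of a row holding a common line of class k would need σₚ(k) = σᵤ(k). Row i thus holds
-- q² distinct lines of Rᵢ, which has exactly q² lines. Conversely, σₚ(k) is the row in which
-- column p holds its line of class k. Once U_T = U_𝒜 and no row or column repeats a symbol,
-- the triple-array numbers are those of 𝒜: every line occurs q times, |Rᵢ ∩ Cⱼ| = q,
-- |Rᵢ ∩ Rᵢ′| = (q − 1) q and |Cⱼ ∩ Cⱼ′| = 1.

open import Defs
open import Algebra.Bundles using (CommutativeMonoid)
open import Data.Bool using (Bool; true; false; if_then_else_; _∧_; not)
open import Data.Bool.Properties using (∧-identityʳ; ∧-zeroʳ; ∧-commutativeMonoid)
open import Data.Fin using (Fin; zero; suc; _≟_)
open import Data.Fin.Properties using (suc-injective)
open import Data.Fin.Permutation using (Permutation′; _⟨$⟩ʳ_; _⟨$⟩ˡ_; permutation; inverseˡ; inverseʳ)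
open import Data.Nat using (ℕ; zero; suc; _+_; _*_; _∸_; _≤_; z≤n; s≤s; z<s; NonZero; >-nonZero; pred)
open import Data.Nat.Properties using (module ≤-Reasoning; +-*-semiring; +-suc; +-identityʳ; *-identityʳ; *-cancelʳ-≡; ≤-reflexive; <-≤-trans; m≤n⇒m≤1+n; 1+n≰n)
open import Data.Product using (Σ; _×_; _,_; proj₁; proj₂)
open import Function.Base using (_∘_)
open import Function.Bundles using (_⇔_; mk⇔; Equivalence)
import Function.Properties.Equivalence as ⇔
open import Relation.Binary.PropositionalEquality using (_≡_; _≢_; refl; sym; trans; cong; cong₂; subst; module ≡-Reasoning)
open import Relation.Nullary using (yes; no; contradiction)
open import Algebra.Properties.Semiring.Sum +-*-semiring using (sum; sum-cong-≗; ∑-comm; *-distribʳ-sum)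
open import Algebra.Properties.CommutativeSemigroup (CommutativeMonoid.commutativeSemigroup ∧-commutativeMonoid) using (x∙yz≈y∙xz)

open Equivalence using (to; from)

private
  variable
    m n a : ℕ

[_] : Bool → ℕ
[ b ] = if b then 1 else 0

eqb-⇔ : {x y : Fin n} → eqb x y ≡ true ⇔ x ≡ y
eqb-⇔ {x = x} {y} with x ≟ y
... | yes x≡y = mk⇔ (λ _ → x≡y) (λ _ → refl)
... | no x≢y = mk⇔ (λ ()) (λ x≡y → contradiction x≡y x≢y)

not-eqb-⇔ : {x y : Fin n} → not (eqb x y) ≡ true ⇔ x ≢ y
not-eqb-⇔ {x = x} {y} with x ≟ y
... | yes x≡y = mk⇔ (λ ()) (λ x≢y → contradiction x≡y x≢y)
... | no x≢y = mk⇔ (λ _ → x≢y) (λ _ → refl)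

eqb-refl : (x : Fin n) → eqb x x ≡ true
eqb-refl x = from eqb-⇔ refl

anyF-⇔ : {f : Fin n → Bool} → anyF f ≡ true ⇔ Σ (Fin n) (λ x → f x ≡ true)
anyF-⇔ = mk⇔ witness (λ (x , fx) → intro x fx)
  where
  witness : ∀ {n} {f : Fin n → Bool} → anyF f ≡ true → Σ (Fin n) (λ x → f x ≡ true)
  witness {suc n} {f} e with f zero in f0
  ... | true = zero , f0
  ... | false = let x , fx = witness e in suc x , fx
  intro : ∀ {n} {f : Fin n → Bool} x → f x ≡ true → anyF f ≡ true
  intro zero fx rewrite fx = refl
  intro {f = f} (suc x) fx with f zero
  ... | true = refl
  ... | false = intro x fx

occurs-⇔ : {f : Fin n → Fin m} {s : Fin m} →
  anyF (λ x → eqb (f x) s) ≡ true ⇔ Σ (Fin n) (λ x → f x ≡ s)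
occurs-⇔ = mk⇔ (λ e → let x , p = to anyF-⇔ e in x , to eqb-⇔ p)
               (λ (x , p) → from anyF-⇔ (x , from eqb-⇔ p))

≡-from-⇔ : {b c : Bool} → b ≡ true ⇔ c ≡ true → b ≡ c
≡-from-⇔ {true} {true} _ = refl
≡-from-⇔ {true} {false} b⇔c = sym (to b⇔c refl)
≡-from-⇔ {false} {true} b⇔c = from b⇔c refl
≡-from-⇔ {false} {false} _ = refl

∧-true⁻ : {b c : Bool} → b ∧ c ≡ true → b ≡ true × c ≡ true
∧-true⁻ {true} c≡true = refl , c≡true

sumF≡sum : (f : Fin n → ℕ) → sumF f ≡ sum f
sumF≡sum {zero} f = refl
sumF≡sum {suc n} f = cong (f zero +_) (sumF≡sum (λ x → f (suc x)))

count≡sum : (f : Fin n → Bool) → count f ≡ sum (λ x → [ f x ])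
count≡sum {zero} f = refl
count≡sum {suc n} f = cong ([ f zero ] +_) (count≡sum (λ x → f (suc x)))

count-cong : {f g : Fin n → Bool} → (∀ x → f x ≡ g x) → count f ≡ count g
count-cong {zero} f≗g = refl
count-cong {suc n} f≗g = cong₂ _+_ (cong [_] (f≗g zero)) (count-cong (λ x → f≗g (suc x)))

count-true : count {n} (λ _ → true) ≡ n
count-true {zero} = refl
count-true {suc n} = cong suc count-true

count-none : {f : Fin n → Bool} → (∀ x → f x ≡ false) → count f ≡ 0
count-none {zero} none = refl
count-none {suc n} none rewrite none zero = count-none (λ x → none (suc x))

count-mono : {f g : Fin n → Bool} → (∀ x → f x ≡ true → g x ≡ true) → count f ≤ count g
count-mono {zero} f⊆g = z≤n
count-mono {suc n} {f} {g} f⊆g with f zero in f0 | g zero in g0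
... | true | true = s≤s (count-mono (λ x → f⊆g (suc x)))
... | true | false = contradiction (trans (sym g0) (f⊆g zero f0)) (λ ())
... | false | true = m≤n⇒m≤1+n (count-mono (λ x → f⊆g (suc x)))
... | false | false = count-mono (λ x → f⊆g (suc x))

-- Stated without eqb because ⌊ suc x ≟ suc y ⌋ does not reduce to ⌊ x ≟ y ⌋.
count-except : {f g : Fin n → Bool} (x : Fin n) → f x ≡ true → g x ≡ false →
  (∀ y → y ≢ x → g y ≡ f y) → count f ≡ suc (count g)
count-except {suc n} zero fx gx g≗f rewrite fx | gx =
  cong suc (sym (count-cong (λ y → g≗f (suc y) (λ ()))))
count-except {suc n} {f} {g} (suc x) fx gx g≗f rewrite g≗f zero (λ ()) =
  trans (cong ([ f zero ] +_) (count-except x fx gx (λ y y≢x → g≗f (suc y) (y≢x ∘ suc-injective))))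
        (+-suc [ f zero ] _)

count-unique : {f : Fin n → Bool} (x : Fin n) → f x ≡ true →
  (∀ y → f y ≡ true → y ≡ x) → count f ≡ 1
count-unique {n} {f} x fx unique =
  trans (count-except {g = λ _ → false} x fx refl only-x) (cong suc (count-none {n} (λ _ → refl)))
  where
  only-x : ∀ y → y ≢ x → false ≡ f y
  only-x y y≢x with f y in fy
  ... | false = refl
  ... | true = contradiction (unique y fy) y≢x

count-remove : {f : Fin n → Bool} (x : Fin n) → f x ≡ true →
  count f ≡ suc (count (λ y → f y ∧ not (eqb y x)))
count-remove {f = f} x fx = count-except x fx removed kept
  where
  removed : f x ∧ not (eqb x x) ≡ false
  removed = trans (cong (λ b → f x ∧ not b) (eqb-refl x)) (∧-zeroʳ (f x))
  kept : ∀ y → y ≢ x → f y ∧ not (eqb y x) ≡ f y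
  kept y y≢x = trans (cong (f y ∧_) (from not-eqb-⇔ y≢x)) (∧-identityʳ (f y))

count-≤⇒⊇ : {f g : Fin n → Bool} → (∀ x → f x ≡ true → g x ≡ true) → count g ≤ count f →
  ∀ x → g x ≡ true → f x ≡ true
count-≤⇒⊇ {n} {f} {g} f⊆g g≤f x gx with f x in fx
... | true = refl
... | false = contradiction (begin
  suc (count g-x)   ≡⟨ count-remove x gx ⟨
  count g           ≤⟨ g≤f ⟩
  count f           ≤⟨ count-mono f⊆g-x ⟩
  count g-x         ∎) 1+n≰n
  where
  open ≤-Reasoning
  g-x : Fin n → Bool
  g-x y = g y ∧ not (eqb y x)
  f⊆g-x : ∀ y → f y ≡ true → g-x y ≡ true
  f⊆g-x y fy = cong₂ _∧_ (f⊆g y fy) (from not-eqb-⇔ λ { refl → contradiction (trans (sym fx) fy) λ () })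

count-atMostOne : {f : Fin n → Bool} → (∀ x y → f x ≡ true → f y ≡ true → x ≡ y) →
  count f ≡ [ anyF f ]
count-atMostOne {f = f} atMostOne with anyF f in some
... | true = let x , fx = to anyF-⇔ some in count-unique x fx (λ y fy → atMostOne y x fy fx)
... | false = count-none none
  where
  none : ∀ x → f x ≡ false
  none x with f x in fx
  ... | false = refl
  ... | true = contradiction (trans (sym some) (from anyF-⇔ (x , fx))) λ ()

count-eqb-∧ : (x : Fin n) (f : Fin n → Bool) → count (λ k → eqb x k ∧ f k) ≡ [ f x ]
count-eqb-∧ x f with f x in fx
... | true = count-unique x (cong₂ _∧_ (eqb-refl x) fx) (λ k e → sym (to eqb-⇔ (proj₁ (∧-true⁻ e))))
... | false = count-none off-diagonal
  where
  off-diagonal : ∀ k → eqb x k ∧ f k ≡ false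
  off-diagonal k with x ≟ k
  ... | yes refl = fx
  ... | no _ = refl

count-∧ˡ : (b : Bool) (f : Fin n → Bool) → count (λ x → b ∧ f x) ≡ [ b ] * count f
count-∧ˡ true f = sym (+-identityʳ (count f))
count-∧ˡ {n} false f = count-none {n} (λ _ → refl)

∑-count-comm : (R : Fin m → Fin n → Bool) →
  sum (λ i → count (R i)) ≡ sum (λ j → count (λ i → R i j))
∑-count-comm R = begin
  sum (λ i → count (R i))                  ≡⟨ sum-cong-≗ (λ i → count≡sum (R i)) ⟩
  sum (λ i → sum (λ j → [ R i j ]))        ≡⟨ ∑-comm (λ i j → [ R i j ]) ⟩
  sum (λ j → sum (λ i → [ R i j ]))        ≡⟨ sum-cong-≗ (λ j → sym (count≡sum (λ i → R i j))) ⟩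
  sum (λ j → count (λ i → R i j))          ∎
  where open ≡-Reasoning

∑-count-∧ˡ : (g : Fin m → Bool) (h : Fin m → Fin n → Bool) → (∀ k → count (h k) ≡ a) →
  sum (λ k → count (λ x → g k ∧ h k x)) ≡ count g * a
∑-count-∧ˡ {a = a} g h |h|≡a = begin
  sum (λ k → count (λ x → g k ∧ h k x))    ≡⟨ sum-cong-≗ (λ k → trans (count-∧ˡ (g k) (h k)) (cong ([ g k ] *_) (|h|≡a k))) ⟩
  sum (λ k → [ g k ] * a)                  ≡⟨ sym (*-distribʳ-sum a (λ k → [ g k ])) ⟩
  sum (λ k → [ g k ]) * a                  ≡⟨ cong (_* a) (sym (count≡sum g)) ⟩
  count g * a                              ∎
  where open ≡-Reasoning

count-fibres : (c : Fin n → Fin m) (g : Fin m → Bool) (h : Fin n → Bool) →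
  (∀ k → count (λ x → eqb (c x) k ∧ h x) ≡ a) → count (λ x → g (c x) ∧ h x) ≡ count g * a
count-fibres {a = a} c g h fibre = begin
  count (λ x → g (c x) ∧ h x)                           ≡⟨ count≡sum (λ x → g (c x) ∧ h x) ⟩
  sum (λ x → [ g (c x) ∧ h x ])                          ≡⟨ sum-cong-≗ (λ x → sym (count-eqb-∧ (c x) (λ k → g k ∧ h x))) ⟩
  sum (λ x → count (λ k → eqb (c x) k ∧ (g k ∧ h x)))   ≡⟨ ∑-count-comm (λ x k → eqb (c x) k ∧ (g k ∧ h x)) ⟩
  sum (λ k → count (λ x → eqb (c x) k ∧ (g k ∧ h x)))   ≡⟨ sum-cong-≗ (λ k → count-cong (λ x → x∙yz≈y∙xz (eqb (c x) k) (g k) (h x))) ⟩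
  sum (λ k → count (λ x → g k ∧ (eqb (c x) k ∧ h x)))   ≡⟨ ∑-count-∧ˡ g (λ k x → eqb (c x) k ∧ h x) fibre ⟩
  count g * a                                            ∎
  where open ≡-Reasoning

count-preimage : {f : Fin n → Fin m} → (∀ x y → f x ≡ f y → x ≡ y) → (s : Fin m) →
  count (λ x → eqb (f x) s) ≡ [ anyF (λ x → eqb (f x) s) ]
count-preimage injective s =
  count-atMostOne (λ x y fx≡s fy≡s → injective x y (trans (to eqb-⇔ fx≡s) (sym (to eqb-⇔ fy≡s))))

count-image : {f : Fin n → Fin m} → (∀ x y → f x ≡ f y → x ≡ y) →
  count (λ s → anyF (λ x → eqb (f x) s)) ≡ n
count-image {n} {m} {f} injective = begin
  count (λ s → anyF (λ x → eqb (f x) s))    ≡⟨ count≡sum {m} _ ⟩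
  sum (λ s → [ anyF (λ x → eqb (f x) s) ])  ≡⟨ sum-cong-≗ (λ s → sym (count-preimage injective s)) ⟩
  sum (λ s → count (λ x → eqb (f x) s))     ≡⟨ ∑-count-comm (λ s x → eqb (f x) s) ⟩
  sum (λ x → count (λ s → eqb (f x) s))     ≡⟨ sum-cong-≗ (λ x → count-unique (f x) (eqb-refl (f x)) (λ s e → sym (to eqb-⇔ e))) ⟩
  sum {n} (λ _ → [ true ])                  ≡⟨ sym (count≡sum {n} (λ _ → true)) ⟩
  count {n} (λ _ → true)                    ≡⟨ count-true ⟩
  n                                         ∎
  where open ≡-Reasoning

count-≢ : (i : Fin (suc n)) → count (λ k → not (eqb k i)) ≡ n
count-≢ i = cong pred (trans (sym (count-remove {f = λ _ → true} i refl)) count-true)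

count-≢₂ : {i i′ : Fin (suc n)} → i ≢ i′ →
  count (λ k → not (eqb k i) ∧ not (eqb k i′)) ≡ n ∸ 1
count-≢₂ {i = i} {i′} i≢i′ =
  cong pred (trans (sym (count-remove {f = λ k → not (eqb k i)} i′ (from not-eqb-⇔ (i≢i′ ∘ sym)))) (count-≢ i))

module _ {q : ℕ} (A : AffinePlane q) where
  open AffinePlane A

  private
    Point Line Class : Set
    Point = Fin (q * q)
    Line = Fin nLines
    Class = Fin (suc q)

    instance
      q-nonZero : NonZero q
      q-nonZero = >-nonZero (<-≤-trans z<s order≥2)

  line : Class → Point → Line
  line k p = proj₁ (classPartition k p)

  cls-line : (k : Class) (p : Point) → cls (line k p) ≡ k
  cls-line k p = proj₁ (proj₂ (classPartition k p))

  inc-line : (k : Class) (p : Point) → inc p (line k p) ≡ true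
  inc-line k p = proj₂ (proj₂ (classPartition k p))

  line-unique : {k : Class} {p : Point} {l : Line} → cls l ≡ k → inc p l ≡ true → line k p ≡ l
  line-unique {k} {p} {l} cls≡k p∈l = classDisjoint k p (line k p) l (cls-line k p) cls≡k (inc-line k p) p∈l

  linesThrough-inClass : (p : Point) (k : Class) → count (λ l → eqb (cls l) k ∧ inc p l) ≡ 1
  linesThrough-inClass p k = count-unique (line k p)
    (cong₂ _∧_ (from eqb-⇔ (cls-line k p)) (inc-line k p))
    (λ l e → let cls≡k , p∈l = ∧-true⁻ e in sym (line-unique (to eqb-⇔ cls≡k) p∈l))

  linesThrough₂ : {p u : Point} → p ≢ u → count (λ l → inc p l ∧ inc u l) ≡ 1
  linesThrough₂ {p} {u} p≢u with joinExists p u p≢u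
  ... | l , p∈l , u∈l = count-unique l (cong₂ _∧_ p∈l u∈l)
    (λ l′ e → let p∈l′ , u∈l′ = ∧-true⁻ e in joinUnique p u p≢u l′ l p∈l′ u∈l′ p∈l u∈l)

  -- Double counting of the flags (p, l) with l ∈ 𝓛ₖ: every point lies on one such l,
  -- every such l carries q points.
  classSize : (k : Class) → count (λ l → eqb (cls l) k) ≡ q
  classSize k = *-cancelʳ-≡ _ q q (begin
    count (λ l → eqb (cls l) k) * q                        ≡⟨ sym (∑-count-∧ˡ (λ l → eqb (cls l) k) (λ l p → inc p l) lineSize) ⟩
    sum (λ l → count (λ p → eqb (cls l) k ∧ inc p l))     ≡⟨ sym (∑-count-comm (λ p l → eqb (cls l) k ∧ inc p l)) ⟩
    sum (λ p → count (λ l → eqb (cls l) k ∧ inc p l))     ≡⟨ sum-cong-≗ (λ p → linesThrough-inClass p k) ⟩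
    sum {q * q} (λ _ → [ true ])                           ≡⟨ sym (count≡sum {q * q} (λ _ → true)) ⟩
    count {q * q} (λ _ → true)                             ≡⟨ count-true ⟩
    q * q                                                  ∎)
    where open ≡-Reasoning

  count-byClass : (g : Class → Bool) → count (λ l → g (cls l)) ≡ count g * q
  count-byClass g = begin
    count (λ l → g (cls l))          ≡⟨ count-cong (λ l → sym (∧-identityʳ (g (cls l)))) ⟩
    count (λ l → g (cls l) ∧ true)   ≡⟨ count-fibres cls g (λ _ → true) (λ k → trans (count-cong (λ l → ∧-identityʳ (eqb (cls l) k))) (classSize k)) ⟩
    count g * q                      ∎
    where open ≡-Reasoning

  linesOffClass : (i : Class) → count (λ l → not (eqb (cls l) i)) ≡ q * q
  linesOffClass i = trans (count-byClass (λ k → not (eqb k i))) (cong (_* q) (count-≢ i))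

  linesOffClasses : {i i′ : Class} → i ≢ i′ →
    count (λ l → not (eqb (cls l) i) ∧ not (eqb (cls l) i′)) ≡ (q ∸ 1) * q
  linesOffClasses {i} {i′} i≢i′ =
    trans (count-byClass (λ k → not (eqb k i) ∧ not (eqb k i′))) (cong (_* q) (count-≢₂ i≢i′))

  linesThrough-offClass : (p : Point) (i : Class) → count (λ l → not (eqb (cls l) i) ∧ inc p l) ≡ q
  linesThrough-offClass p i = begin
    count (λ l → not (eqb (cls l) i) ∧ inc p l)   ≡⟨ count-fibres cls (λ k → not (eqb k i)) (λ l → inc p l) (linesThrough-inClass p) ⟩
    count (λ k → not (eqb k i)) * 1               ≡⟨ *-identityʳ _ ⟩
    count (λ k → not (eqb k i))                   ≡⟨ count-≢ i ⟩
    q                                              ∎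
    where open ≡-Reasoning

  realizesUA⇒isTripleArray : (T : Array (suc q) (q * q) nLines) →
    (∀ i j j′ → T i j ≡ T i j′ → j ≡ j′) → (∀ j i i′ → T i j ≡ T i′ j → i ≡ i′) →
    RealizesUA A T → IsTripleArray T
  realizesUA⇒isTripleArray T rowNoRepeat colNoRepeat (rows , cols) = record
    { rowNoRepeat = rowNoRepeat
    ; colNoRepeat = colNoRepeat
    ; equireplicate = q , replication
    ; rowColConst = q , λ i j →
        trans (count-cong (λ l → cong₂ _∧_ (inRow≡R i l) (inCol≡C j l))) (linesThrough-offClass j i)
    ; rowRowConst = (q ∸ 1) * q , λ i i′ i≢i′ →
        trans (count-cong (λ l → cong₂ _∧_ (inRow≡R i l) (inRow≡R i′ l))) (linesOffClasses i≢i′)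
    ; colColConst = 1 , λ j j′ j≢j′ →
        trans (count-cong (λ l → cong₂ _∧_ (inCol≡C j l) (inCol≡C j′ l))) (linesThrough₂ j≢j′)
    }
    where
    inRow≡R : (i : Class) (l : Line) → inRow T i l ≡ not (eqb (cls l) i)
    inRow≡R i l = ≡-from-⇔ (⇔.trans occurs-⇔ (⇔.trans (rows i l) (⇔.sym not-eqb-⇔)))

    inCol≡C : (j : Point) (l : Line) → inCol T j l ≡ inc j l
    inCol≡C j l = ≡-from-⇔ (⇔.trans occurs-⇔ (cols j l))

    replication : (l : Line) → occ T l ≡ q
    replication l = begin
      occ T l                                   ≡⟨ sumF≡sum (λ i → count (λ j → eqb (T i j) l)) ⟩
      sum (λ i → count (λ j → eqb (T i j) l))   ≡⟨ ∑-count-comm (λ i j → eqb (T i j) l) ⟩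
      sum (λ j → count (λ i → eqb (T i j) l))   ≡⟨ sum-cong-≗ (λ j → count-preimage (λ i → colNoRepeat j i) l) ⟩
      sum (λ j → [ inCol T j l ])               ≡⟨ sum-cong-≗ (λ j → cong [_] (inCol≡C j l)) ⟩
      sum (λ j → [ inc j l ])                   ≡⟨ sym (count≡sum (λ j → inc j l)) ⟩
      count (λ j → inc j l)                     ≡⟨ lineSize l ⟩
      q                                         ∎
      where open ≡-Reasoning

  derangements⇒tripleArray :
    (Σ (Point → Permutation′ (suc q)) λ σ → GoodDerangementAssignment A σ) →
    Σ (Array (suc q) (q * q) nLines) λ T → IsTripleArray T × RealizesUA A T
  derangements⇒tripleArray (σ , derangement , separating) =
    T , realizesUA⇒isTripleArray T rowNoRepeat colNoRepeat realizes , realizes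
    where
    T : Array (suc q) (q * q) nLines
    T i p = line (σ p ⟨$⟩ˡ i) p

    σ-cls-T : ∀ i p → σ p ⟨$⟩ʳ cls (T i p) ≡ i
    σ-cls-T i p = trans (cong (σ p ⟨$⟩ʳ_) (cls-line _ p)) (inverseʳ (σ p))

    colNoRepeat : ∀ p i i′ → T i p ≡ T i′ p → i ≡ i′
    colNoRepeat p i i′ Tip≡Ti′p =
      trans (sym (σ-cls-T i p)) (trans (cong (λ l → σ p ⟨$⟩ʳ cls l) Tip≡Ti′p) (σ-cls-T i′ p))

    rowNoRepeat : ∀ i p u → T i p ≡ T i u → p ≡ u
    rowNoRepeat i p u Tip≡Tiu with p ≟ u
    ... | yes p≡u = p≡u
    ... | no p≢u = contradiction
      (trans (σ-cls-T i p) (sym (trans (cong (λ l → σ u ⟨$⟩ʳ cls l) Tip≡Tiu) (σ-cls-T i u))))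
      (separating p u p≢u (T i p) (inc-line _ p) (subst (λ l → inc u l ≡ true) (sym Tip≡Tiu) (inc-line _ u)))

    row-avoids : ∀ i p → cls (T i p) ≢ i
    row-avoids i p cls≡i = derangement p i (trans (cong (σ p ⟨$⟩ʳ_) (sym cls≡i)) (σ-cls-T i p))

    inRow⊆R : ∀ i l → inRow T i l ≡ true → not (eqb (cls l) i) ≡ true
    inRow⊆R i l l∈row = let p , Tip≡l = to occurs-⇔ l∈row in
      from not-eqb-⇔ (subst (λ l → cls l ≢ i) Tip≡l (row-avoids i p))

    -- Row i lists q² distinct lines of Rᵢ, and |Rᵢ| = q².
    R⊆inRow : ∀ i l → cls l ≢ i → Σ Point (λ p → T i p ≡ l)
    R⊆inRow i l l∉Li = to occurs-⇔ (count-≤⇒⊇ (inRow⊆R i) |R|≤|row| l (from not-eqb-⇔ l∉Li))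
      where
      |R|≤|row| : count (λ l → not (eqb (cls l) i)) ≤ count (inRow T i)
      |R|≤|row| = ≤-reflexive (trans (linesOffClass i) (sym (count-image (rowNoRepeat i))))

    realizes : RealizesUA A T
    realizes =
      (λ i l → mk⇔ (λ (p , Tip≡l) → subst (λ l → cls l ≢ i) Tip≡l (row-avoids i p)) (R⊆inRow i l)) ,
      (λ p l → mk⇔ (λ (i , Tip≡l) → subst (λ l → inc p l ≡ true) Tip≡l (inc-line _ p))
                   (λ p∈l → σ p ⟨$⟩ʳ cls l ,
                            trans (cong (λ k → line k p) (inverseˡ (σ p))) (line-unique refl p∈l)))

  tripleArray⇒derangements :
    (Σ (Array (suc q) (q * q) nLines) λ T → IsTripleArray T × RealizesUA A T) →
    Σ (Point → Permutation′ (suc q)) λ σ → GoodDerangementAssignment A σ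
  tripleArray⇒derangements (T , tripleArray , rows , cols) = σ , derangement , separating
    where
    open IsTripleArray tripleArray using (rowNoRepeat; colNoRepeat)

    rowOf : Point → Class → Class
    rowOf p k = proj₁ (from (cols p (line k p)) (inc-line k p))

    T-rowOf : ∀ p k → T (rowOf p k) p ≡ line k p
    T-rowOf p k = proj₂ (from (cols p (line k p)) (inc-line k p))

    rowOf-cls : ∀ p i → rowOf p (cls (T i p)) ≡ i
    rowOf-cls p i = colNoRepeat p _ i
      (trans (T-rowOf p _) (line-unique refl (to (cols p (T i p)) (i , refl))))

    cls-rowOf : ∀ p k → cls (T (rowOf p k) p) ≡ k
    cls-rowOf p k = trans (cong cls (T-rowOf p k)) (cls-line k p)

    σ : Point → Permutation′ (suc q)
    σ p = permutation (rowOf p) (λ i → cls (T i p)) (rowOf-cls p) (cls-rowOf p)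

    derangement : ∀ p k → σ p ⟨$⟩ʳ k ≢ k
    derangement p k rowOf≡k =
      to (rows (rowOf p k) (line k p)) (p , T-rowOf p k) (trans (cls-line k p) (sym rowOf≡k))

    separating : ∀ p u → p ≢ u → ∀ l → inc p l ≡ true → inc u l ≡ true →
      σ p ⟨$⟩ʳ cls l ≢ σ u ⟨$⟩ʳ cls l
    separating p u p≢u l p∈l u∈l same-row = p≢u (rowNoRepeat (rowOf p k) p u (begin
      T (rowOf p k) p   ≡⟨ T-rowOf p k ⟩
      line k p          ≡⟨ line-unique refl p∈l ⟩
      l                 ≡⟨ sym (line-unique refl u∈l) ⟩
      line k u          ≡⟨ sym (T-rowOf u k) ⟩
      T (rowOf u k) u   ≡⟨ cong (λ i → T i u) (sym same-row) ⟩
      T (rowOf p k) u   ∎))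
      where
      open ≡-Reasoning
      k : Class
      k = cls l

proposition3 : (q : ℕ) (A : AffinePlane q) →
    (Σ (Fin (q * q) → Permutation′ (suc q)) λ σ → GoodDerangementAssignment A σ)
    ⇔ (Σ (Array (suc q) (q * q) (AffinePlane.nLines A)) λ T →
         IsTripleArray T × RealizesUA A T)
proposition3 q A = mk⇔ (derangements⇒tripleArray A) (tripleArray⇒derangements A)
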